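{- Let $m,n\ge 0$ and $0\le r\le n$, and take $H=\varnothing$, $V=\{1,\dots,r\}$. Then $$\sum_{p\in\mathcal P_{m,n}} q^{\mathrm{CINDEX}^{(H,V)}(p)}\,t^{\mathrm{CORNERS}^{(H,V)}(p)} = q^{\binom{r+1}{2}}\sum_c \begin{bmatrix} m+r\\ c\end{bmatrix}_q\begin{bmatrix} n-r\\ c-r\end{bmatrix}_q q^{c(c-r)}\,t^c .$$
   Context: The grid $G_{m,n}$ has nodes $(i,j)$, $0\le i\le m$ (row, downward), $0\le j\le n$ (column, rightward). $\mathcal P_{m,n}$ is the set of lattice paths from $(0,0)$ to $(m,n)$ with unit down and right steps. A true corner is a node where a right step is immediately followed by a down step. For $V\subseteq\{1,\dots,n\}$ (and $H=\varnothing$), each $v\in V$ marks the node reached by the path's $v$-th right step. $\mathrm{CORNERS}^{(H,V)}(p)$ is the number of nodes that are true corners or marked (each node counted once), and $\mathrm{CINDEX}^{(H,V)}(p)$ is the sum of $i+j$ over these nodes $(i,j)$. $\begin{bmatrix} a\\ b\end{bmatrix}_q$ is the Gaussian polynomial, zero when $b<0$ or $b>a$; the sum is over all integers $c$. -}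

module Defs where

open import Level using (Level)
open import Data.Nat using (ℕ; zero; suc; _+_; _*_; _∸_; _≤ᵇ_)
open import Data.Nat.Combinatorics using (_C_)
open import Data.Bool using (Bool; true; false; _∨_; if_then_else_)
open import Data.List using (List; []; _∷_; map; _++_; length; upTo)
open import Data.Product using (_×_; _,_)
open import Algebra.Bundles using (CommutativeSemiring)

-- Unit steps of a lattice path: D = down (row i+1), R = right (column j+1).
data Step : Set where
  D R : Step

-- The set P_{m,n} of lattice paths from (0,0) to (m,n), listed (without
-- repetition) as step sequences.
paths : ℕ → ℕ → List (List Step)
paths zero    zero    = [] ∷ []
paths (suc m) zero    = map (D ∷_) (paths m zero)
paths zero    (suc n) = map (R ∷_) (paths zero n)
paths (suc m) (suc n) = map (D ∷_) (paths m (suc n)) ++ map (R ∷_) (paths (suc m) n)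

startsDown : List Step → Bool
startsDown (D ∷ _) = true
startsDown _       = false

-- The nodes counted by CORNERS^{(H,V)} / CINDEX^{(H,V)} with H = ∅ and V
-- given as a boolean predicate on {1,...,n}.  Arguments: V, current node
-- (i , j), remaining steps.  After a right step the new node is (i , j+1)
-- and it is reached by the (j+1)-th right step; it is counted (once) if it
-- is a true corner (next step is down) or is marked ((j+1) ∈ V).
-- Down steps never produce true corners or (for H = ∅) marks.
countedNodes : (ℕ → Bool) → ℕ → ℕ → List Step → List (ℕ × ℕ)
countedNodes V i j []      = []
countedNodes V i j (D ∷ s) = countedNodes V (suc i) j s
countedNodes V i j (R ∷ s) =
  if startsDown s ∨ V (suc j)
  then (i , suc j) ∷ countedNodes V i (suc j) s
  else countedNodes V i (suc j) s

sumℕ : List ℕ → ℕ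
sumℕ []       = 0
sumℕ (x ∷ xs) = x + sumℕ xs

CORNERS : (ℕ → Bool) → List Step → ℕ
CORNERS V p = length (countedNodes V 0 0 p)

CINDEX : (ℕ → Bool) → List Step → ℕ
CINDEX V p = sumℕ (map (λ { (i , j) → i + j }) (countedNodes V 0 0 p))

upToSet : ℕ → ℕ → Bool
upToSet r v = v ≤ᵇ r   -- (v ≥ 1 holds automatically for marked indices)

-- Polynomial-valued quantities, evaluated in an arbitrary commutative
-- semiring (an identity in all commutative semirings is exactly an
-- identity of polynomials in ℕ[q,t], the free one on q,t).
module Poly {c ℓ : Level} (S : CommutativeSemiring c ℓ) where
  open CommutativeSemiring S renaming (Carrier to A; _+_ to _⊕_; _*_ to _⊗_)
  open import Algebra.Definitions.RawSemiring rawSemiring using (_^_) public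

  Σ : List A → A
  Σ []       = 0#
  Σ (x ∷ xs) = x ⊕ Σ xs

  -- Gaussian polynomial [a choose b]_q (for natural b; zero when b > a),
  -- via the q-Pascal recursion
  -- [a+1 choose b+1] = [a choose b] + q^{b+1} [a choose b+1].
  gauss : A → ℕ → ℕ → A
  gauss q a       zero    = 1#
  gauss q zero    (suc b) = 0#
  gauss q (suc a) (suc b) = gauss q a b ⊕ (q ^ suc b) ⊗ gauss q a (suc b)

  -- [a choose c - r]_q for integer c - r: zero when c < r.
  gaussShift : A → ℕ → ℕ → ℕ → A
  gaussShift q a c r = if r ≤ᵇ c then gauss q a (c ∸ r) else 0#

  lhs : A → A → ℕ → ℕ → ℕ → A
  lhs q t m n r =
    Σ (map (λ p → (q ^ CINDEX (upToSet r) p) ⊗ (t ^ CORNERS (upToSet r) p))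
           (paths m n))

  -- Right-hand side; the sum over all integers c reduces to 0 ≤ c ≤ m + n
  -- (all other terms vanish: the q-binomials are zero for c < 0 or c > m + r,
  -- and m + r ≤ m + n).
  rhs : A → A → ℕ → ℕ → ℕ → A
  rhs q t m n r =
    (q ^ (suc r C 2)) ⊗
    Σ (map (λ c → gauss q (m + r) c ⊗ gaussShift q (n ∸ r) c r
                   ⊗ (q ^ (c * (c ∸ r))) ⊗ (t ^ c))
           (upTo (suc (m + n))))

module Submission where

-- Walking along a path, a counted node (i , j) contributes
-- q^(i+j) t, so we carry the running value u = q^(i+j) t of the current node
-- (multiplied by q at every step) and the number k of marks still to come.
-- This gives a weight `weight k u s` of the remaining steps s defined by
-- one-step recursion (with a companion `pending` for a node reached by an
-- unmarked right step), and the transfer lemma identifies q^CINDEX t^CORNERS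
-- of a path p with `weight r t p`.
--
-- Written with a = m + r and b = n - r, the right-hand side
-- satisfies the recursions that splitting paths by their first step gives
-- for the weight sums: termwise this is the q-Pascal rule for Gaussian
-- polynomials plus exponent bookkeeping.  For r = 0 the recursion runs
-- through the paths starting at a potential corner, which get a closed form
-- of their own.

open import Defs
open import Level using (Level)
open import Data.Nat using (ℕ; _≤_)
open import Algebra.Bundles using (CommutativeSemiring)

open import Data.Nat using (zero; suc; _+_; _*_; _∸_; _<_; _<ᵇ_; _≤ᵇ_; pred; s≤s; z≤n; _<?_)
import Data.Nat.Properties as ℕₚ
open import Data.Nat.Combinatorics using (_C_; nCk+nC[k+1]≡[n+1]C[k+1]; nC1≡n)
import Data.Nat.Solver as ℕ-Solver
open import Data.Bool using (Bool; true; false; T; _∨_; if_then_else_)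
open import Data.Bool.Properties using (∨-zeroʳ)
open import Data.List using (List; []; _∷_; map; _++_; length; applyUpTo)
import Data.List.Properties as List
open import Data.Product using (_×_; _,_)
open import Data.Sum using (_⊎_; inj₁; inj₂)
open import Relation.Nullary using (yes; no)
open import Relation.Binary.PropositionalEquality as ≡ using (_≡_)

triangle-suc : ∀ r → suc (suc r) C 2 ≡ suc r + suc r C 2
triangle-suc r = ≡.trans (≡.sym (nCk+nC[k+1]≡[n+1]C[k+1] (suc r) 1))
                         (≡.cong (_+ (suc r C 2)) (nC1≡n (suc r)))

-- Exponent identity behind the q-Pascal step of the closed form (for r ≤ d):
-- C(r+2,2) + (d+1)(d-r) = 1 + C(r+1,2) + d + d(d-r).
corner-exponent : ∀ {r d} → r ≤ d →
  suc (suc r) C 2 + suc d * (d ∸ r) ≡ suc (suc r C 2 + (d + d * (d ∸ r)))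
corner-exponent {r} {d} r≤d = begin
  suc (suc r) C 2 + (e + d * e)       ≡⟨ ≡.cong (_+ (e + d * e)) (triangle-suc r) ⟩
  suc r + c + (e + d * e)             ≡⟨ rearrange r c e (d * e) ⟩
  suc (c + ((r + e) + d * e))         ≡⟨ ≡.cong (λ x → suc (c + (x + d * e))) (ℕₚ.m+[n∸m]≡n r≤d) ⟩
  suc (c + (d + d * e))               ∎
  where
  open ≡.≡-Reasoning
  open ℕ-Solver.+-*-Solver
  e = d ∸ r
  c = suc r C 2
  rearrange : ∀ r c e x → suc r + c + (e + x) ≡ suc (c + ((r + e) + x))
  rearrange = solve 4 (λ r c e x → (con 1 :+ r) :+ c :+ (e :+ x) := con 1 :+ (c :+ ((r :+ e) :+ x))) ≡.refl

-- `Marks V j k`: among the right steps after the j-th one, V marks exactly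
-- the first k.  For V = {1..r} this holds with j = 0 and k = r.
record Marks (V : ℕ → Bool) (j k : ℕ) : Set where
  constructor marks
  field marked : ∀ x → V (suc (x + j)) ≡ (x <ᵇ k)
open Marks

marks-initial : ∀ r → Marks (upToSet r) 0 r
marks-initial r = marks (λ x → ≡.cong (_<ᵇ r) (ℕₚ.+-identityʳ x))

marks-next : ∀ {V j k} → Marks V j k → V (suc j) ≡ (0 <ᵇ k)
marks-next h = marked h 0

suc-<ᵇ : ∀ x k → (suc x <ᵇ k) ≡ (x <ᵇ pred k)
suc-<ᵇ x zero    = ≡.refl
suc-<ᵇ x (suc k) = ≡.refl

marks-step : ∀ {V j k} → Marks V j k → Marks V (suc j) (pred k)
marks-step {V} {j} {k} h = marks (λ x →
  ≡.trans (≡.cong (λ y → V (suc y)) (ℕₚ.+-suc x j)) (≡.trans (marked h (suc x)) (suc-<ᵇ x k)))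

module Proof {c ℓ : Level} (S : CommutativeSemiring c ℓ) (q : CommutativeSemiring.Carrier S) where
  open CommutativeSemiring S renaming (Carrier to A; _+_ to _⊕_; _*_ to _⊗_) hiding (zero)
  open Poly S
  open import Algebra.Properties.CommutativeSemiring.Exp S using (^-homo-*; ^-congʳ; ^-distrib-*)
  open import Algebra.Solver.Ring.NaturalCoefficients.Default S
  open import Relation.Binary.Reasoning.Setoid setoid

  sumTo : ℕ → (ℕ → A) → A
  sumTo zero    f = 0#
  sumTo (suc N) f = f 0 ⊕ sumTo N (λ c → f (suc c))

  sumTo-cong : ∀ N {f g : ℕ → A} → (∀ c → f c ≈ g c) → sumTo N f ≈ sumTo N g
  sumTo-cong zero    e = refl
  sumTo-cong (suc N) e = +-cong (e 0) (sumTo-cong N (λ c → e (suc c)))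

  sumTo-+ : ∀ N (f g : ℕ → A) → sumTo N (λ c → f c ⊕ g c) ≈ sumTo N f ⊕ sumTo N g
  sumTo-+ zero    f g = sym (+-identityˡ 0#)
  sumTo-+ (suc N) f g = trans (+-congˡ (sumTo-+ N (λ c → f (suc c)) (λ c → g (suc c))))
                              (interchange (f 0) (g 0) _ _)
    where
    interchange : ∀ a b x y → (a ⊕ b) ⊕ (x ⊕ y) ≈ (a ⊕ x) ⊕ (b ⊕ y)
    interchange = solve 4 (λ a b x y → (a :+ b) :+ (x :+ y) := (a :+ x) :+ (b :+ y)) refl

  sumTo-* : ∀ N x (f : ℕ → A) → sumTo N (λ c → x ⊗ f c) ≈ x ⊗ sumTo N f
  sumTo-* zero    x f = sym (zeroʳ x)
  sumTo-* (suc N) x f = trans (+-congˡ (sumTo-* N x (λ c → f (suc c)))) (sym (distribˡ x _ _))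

  sumTo-zero : ∀ N (f : ℕ → A) → (∀ c → f c ≈ 0#) → sumTo N f ≈ 0#
  sumTo-zero zero    f h = refl
  sumTo-zero (suc N) f h = trans (+-cong (h 0) (sumTo-zero N (λ c → f (suc c)) (λ c → h (suc c)))) (+-identityˡ 0#)

  sumTo-extend : ∀ N k (f : ℕ → A) → (∀ c → f (N + c) ≈ 0#) → sumTo (N + k) f ≈ sumTo N f
  sumTo-extend zero    k f h = sumTo-zero k f h
  sumTo-extend (suc N) k f h = +-congˡ (sumTo-extend N k (λ c → f (suc c)) h)

  sumTo-last-zero : ∀ N (f : ℕ → A) → f N ≈ 0# → sumTo (suc N) f ≈ sumTo N f
  sumTo-last-zero zero    f h = trans (+-identityʳ _) h
  sumTo-last-zero (suc N) f h = +-congˡ (sumTo-last-zero N (λ c → f (suc c)) h)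

  sumTo-shift : ∀ N (f : ℕ → A) → f 0 ≈ 0# → f N ≈ 0# → sumTo N (λ c → f (suc c)) ≈ sumTo N f
  sumTo-shift N f f0 fN = begin
    sumTo N (λ c → f (suc c))      ≈⟨ +-identityˡ _ ⟨
    0# ⊕ sumTo N (λ c → f (suc c)) ≈⟨ +-congʳ f0 ⟨
    sumTo (suc N) f                ≈⟨ sumTo-last-zero N f fN ⟩
    sumTo N f                      ∎

  Σ-map-applyUpTo : ∀ N (f : ℕ → A) (g : ℕ → ℕ) → Σ (map f (applyUpTo g N)) ≈ sumTo N (λ c → f (g c))
  Σ-map-applyUpTo zero    f g = refl
  Σ-map-applyUpTo (suc N) f g = +-congˡ (Σ-map-applyUpTo N f (λ c → g (suc c)))

  Σ-++ : ∀ (xs ys : List A) → Σ (xs ++ ys) ≈ Σ xs ⊕ Σ ys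
  Σ-++ []       ys = sym (+-identityˡ _)
  Σ-++ (x ∷ xs) ys = trans (+-congˡ (Σ-++ xs ys)) (sym (+-assoc _ _ _))

  Σ-map-cong : ∀ {X : Set} {f g : X → A} (xs : List X) → (∀ x → f x ≈ g x) → Σ (map f xs) ≈ Σ (map g xs)
  Σ-map-cong []       h = refl
  Σ-map-cong (x ∷ xs) h = +-cong (h x) (Σ-map-cong xs h)

  Σ-map-* : ∀ {X : Set} a (f : X → A) (xs : List X) → Σ (map (λ x → a ⊗ f x) xs) ≈ a ⊗ Σ (map f xs)
  Σ-map-* a f []       = sym (zeroʳ a)
  Σ-map-* a f (x ∷ xs) = trans (+-congˡ (Σ-map-* a f xs)) (sym (distribˡ a _ _))

  pathSum : (List Step → A) → ℕ → ℕ → A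
  pathSum w m n = Σ (map w (paths m n))

  pathSum-* : ∀ a (w : List Step → A) m n → pathSum (λ s → a ⊗ w s) m n ≈ a ⊗ pathSum w m n
  pathSum-* a w m n = Σ-map-* a w (paths m n)

  pathSum-down : ∀ (w : List Step → A) m → pathSum w (suc m) zero ≈ pathSum (λ s → w (D ∷ s)) m zero
  pathSum-down w m = reflexive (≡.cong Σ (≡.sym (List.map-∘ (paths m zero))))

  pathSum-right : ∀ (w : List Step → A) n → pathSum w zero (suc n) ≈ pathSum (λ s → w (R ∷ s)) zero n
  pathSum-right w n = reflexive (≡.cong Σ (≡.sym (List.map-∘ (paths zero n))))

  pathSum-split : ∀ (w : List Step → A) m n →
    pathSum w (suc m) (suc n) ≈ pathSum (λ s → w (D ∷ s)) m (suc n) ⊕ pathSum (λ s → w (R ∷ s)) (suc m) n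
  pathSum-split w m n = begin
    Σ (map w (map (D ∷_) downs ++ map (R ∷_) rights))
      ≡⟨ ≡.cong Σ (List.map-++ w (map (D ∷_) downs) (map (R ∷_) rights)) ⟩
    Σ (map w (map (D ∷_) downs) ++ map w (map (R ∷_) rights))
      ≈⟨ Σ-++ (map w (map (D ∷_) downs)) (map w (map (R ∷_) rights)) ⟩
    Σ (map w (map (D ∷_) downs)) ⊕ Σ (map w (map (R ∷_) rights))
      ≡⟨ ≡.cong₂ (λ xs ys → Σ xs ⊕ Σ ys) (≡.sym (List.map-∘ downs)) (≡.sym (List.map-∘ rights)) ⟩
    pathSum (λ s → w (D ∷ s)) m (suc n) ⊕ pathSum (λ s → w (R ∷ s)) (suc m) n ∎
    where
    downs  = paths m (suc n)
    rights = paths (suc m) n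

  -- Relative weights.  `weight k u s` is the weight of the remaining steps s,
  -- where u = q^(i+j) t for the current node (i , j) and k marks are still to
  -- come; `pending u s` is the same when the current node was reached by an
  -- unmarked right step, so that it is a corner iff s starts with a down step.
  mutual
    weight : ℕ → A → List Step → A
    weight k       u []      = 1#
    weight k       u (D ∷ s) = weight k (q ⊗ u) s
    weight zero    u (R ∷ s) = pending (q ⊗ u) s
    weight (suc k) u (R ∷ s) = (q ⊗ u) ⊗ weight k (q ⊗ u) s

    pending : A → List Step → A
    pending u []      = 1#
    pending u (D ∷ s) = u ⊗ weight zero (q ⊗ u) s
    pending u (R ∷ s) = pending (q ⊗ u) s

  mutual
    weight-cong : ∀ k s {u v} → u ≈ v → weight k u s ≈ weight k v s
    weight-cong k       []      e = refl
    weight-cong k       (D ∷ s) e = weight-cong k s (*-congˡ e)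
    weight-cong zero    (R ∷ s) e = pending-cong s (*-congˡ e)
    weight-cong (suc k) (R ∷ s) e = *-cong (*-congˡ e) (weight-cong k s (*-congˡ e))

    pending-cong : ∀ s {u v} → u ≈ v → pending u s ≈ pending v s
    pending-cong []      e = refl
    pending-cong (D ∷ s) e = *-cong e (weight-cong zero s (*-congˡ e))
    pending-cong (R ∷ s) e = pending-cong s (*-congˡ e)

  weightSum : ℕ → A → ℕ → ℕ → A
  weightSum k u m n = pathSum (weight k u) m n

  pendingSum : A → ℕ → ℕ → A
  pendingSum u m n = pathSum (pending u) m n

  nodesWeight : A → List (ℕ × ℕ) → A
  nodesWeight t N = (q ^ sumℕ (map (λ { (i , j) → i + j }) N)) ⊗ (t ^ length N)

  nodesWeight-∷ : ∀ t i j N → nodesWeight t ((i , j) ∷ N) ≈ ((q ^ (i + j)) ⊗ t) ⊗ nodesWeight t N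
  nodesWeight-∷ t i j N = begin
    (q ^ (i + j + Ση)) ⊗ (t ⊗ (t ^ length N))        ≈⟨ *-congʳ (^-homo-* q (i + j) Ση) ⟩
    ((q ^ (i + j)) ⊗ (q ^ Ση)) ⊗ (t ⊗ (t ^ length N)) ≈⟨ interchange _ _ _ _ ⟩
    ((q ^ (i + j)) ⊗ t) ⊗ nodesWeight t N             ∎
    where
    Ση = sumℕ (map (λ { (i , j) → i + j }) N)
    interchange : ∀ a b x y → (a ⊗ b) ⊗ (x ⊗ y) ≈ (a ⊗ x) ⊗ (b ⊗ y)
    interchange = solve 4 (λ a b x y → (a :* b) :* (x :* y) := (a :* x) :* (b :* y)) refl

  value-right : ∀ i j t → (q ^ (i + suc j)) ⊗ t ≈ q ⊗ ((q ^ (i + j)) ⊗ t)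
  value-right i j t = trans (*-congʳ (^-congʳ q (ℕₚ.+-suc i j))) (*-assoc q _ t)

  transfer : ∀ {V j k} → Marks V j k → ∀ i s t →
    nodesWeight t (countedNodes V i j s) ≈ weight k ((q ^ (i + j)) ⊗ t) s
  transfer h i []      t = *-identityˡ 1#
  transfer h i (D ∷ s) t = trans (transfer h (suc i) s t) (weight-cong _ s (*-assoc q _ t))
  transfer {k = k} h i (R ∷ s) t = transfer-right k s (marks-next h) (transfer (marks-step h) i s t)
    where
    -- The node reached by the right step is counted iff it is marked or a
    -- true corner, exactly as `weight` resp. `pending` account for it.
    transfer-right : ∀ {i j t N b} k s → b ≡ (0 <ᵇ k) →
      nodesWeight t N ≈ weight (pred k) ((q ^ (i + suc j)) ⊗ t) s →
      nodesWeight t (if startsDown s ∨ b then (i , suc j) ∷ N else N)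
        ≈ weight k ((q ^ (i + j)) ⊗ t) (R ∷ s)
    transfer-right {i} {j} {t} {N} (suc k) s ≡.refl ih rewrite ∨-zeroʳ (startsDown s) =
      trans (nodesWeight-∷ t i (suc j) N)
            (*-cong (value-right i j t) (trans ih (weight-cong k s (value-right i j t))))
    transfer-right zero []      ≡.refl ih = ih
    transfer-right {i} {j} {t} {N} zero (D ∷ s) ≡.refl ih =
      trans (nodesWeight-∷ t i (suc j) N)
            (*-cong (value-right i j t) (trans ih (weight-cong zero s (*-congˡ (value-right i j t)))))
    transfer-right {i} {j} {t} zero (R ∷ s) ≡.refl ih = trans ih (weight-cong zero (R ∷ s) (value-right i j t))

  lhs≈weightSum : ∀ t m n r → lhs q t m n r ≈ weightSum r t m n
  lhs≈weightSum t m n r = Σ-map-cong (paths m n)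
    (λ p → trans (transfer (marks-initial r) 0 p t) (weight-cong r p (*-identityˡ t)))

  gauss-above : ∀ {a c} → a < c → gauss q a c ≈ 0#
  gauss-above {zero}  {suc c} _ = refl
  gauss-above {suc a} {suc c} (s≤s a<c) =
    trans (+-cong (gauss-above a<c) (trans (*-congˡ (gauss-above (ℕₚ.m<n⇒m<1+n a<c))) (zeroʳ _))) (+-identityˡ 0#)

  gaussShift-suc : ∀ b d r → gaussShift q b (suc d) (suc r) ≡ gaussShift q b d r
  gaussShift-suc b d zero    = ≡.refl
  gaussShift-suc b d (suc r) = ≡.refl

  gaussShift-below : ∀ {b c r} → c < r → gaussShift q b c r ≡ 0#
  gaussShift-below {c = zero}  {suc r} _         = ≡.refl
  gaussShift-below {b} {suc c} {suc r} (s≤s c<r) = ≡.trans (gaussShift-suc b c r) (gaussShift-below c<r)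

  gaussShift-cases : ∀ b d r → gaussShift q b d r ≈ 0# ⊎ r ≤ d
  gaussShift-cases b d r with r ≤ᵇ d in eq
  ... | true  = inj₂ (ℕₚ.≤ᵇ⇒≤ r d (≡.subst T (≡.sym eq) _))
  ... | false = inj₁ refl

  factor₁-zero : ∀ {x} y z w → x ≈ 0# → x ⊗ y ⊗ z ⊗ w ≈ 0#
  factor₁-zero y z w h = trans (*-congʳ (*-congʳ (trans (*-congʳ h) (zeroˡ y))))
                                (trans (*-congʳ (zeroˡ z)) (zeroˡ w))

  factor₂-zero : ∀ x {y} z w → y ≈ 0# → x ⊗ y ⊗ z ⊗ w ≈ 0#
  factor₂-zero x z w h = trans (*-congʳ (*-congʳ (trans (*-congˡ h) (zeroʳ x))))
                                (trans (*-congʳ (zeroˡ z)) (zeroˡ w))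

  term : ℕ → ℕ → ℕ → A → ℕ → A
  term r a b t c = gauss q a c ⊗ gaussShift q b c r ⊗ (q ^ (c * (c ∸ r))) ⊗ (t ^ c)

  closedSum : ℕ → ℕ → ℕ → A → A
  closedSum r a b t = sumTo (suc a) (term r a b t)

  closed : ℕ → ℕ → ℕ → A → A
  closed r a b t = (q ^ (suc r C 2)) ⊗ closedSum r a b t

  term-below : ∀ r a b t {c} → c < r → term r a b t c ≈ 0#
  term-below r a b t {c} c<r = factor₂-zero (gauss q a c) _ _ (reflexive (gaussShift-below c<r))

  term-above : ∀ r a b t {c} → a < c → term r a b t c ≈ 0#
  term-above r a b t a<c = factor₁-zero _ _ _ (gauss-above a<c)

  -- Summing the right-hand side over 0 ≤ c ≤ m + n only adds vanishing terms.
  rhs≈closed : ∀ t m n r → r ≤ n → rhs q t m n r ≈ closed r (m + r) (n ∸ r) t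
  rhs≈closed t m n r r≤n = *-congˡ (begin
    Σ (map f (applyUpTo (λ c → c) (suc (m + n))))  ≈⟨ Σ-map-applyUpTo (suc (m + n)) f (λ c → c) ⟩
    sumTo (suc (m + n)) f                          ≡⟨ ≡.cong (λ N → sumTo (suc N) f) range ⟩
    sumTo (suc (m + r) + (n ∸ r)) f                ≈⟨ sumTo-extend (suc (m + r)) (n ∸ r) f beyond ⟩
    sumTo (suc (m + r)) f                          ∎)
    where
    f = term r (m + r) (n ∸ r) t
    range : m + n ≡ m + r + (n ∸ r)
    range = ≡.sym (≡.trans (ℕₚ.+-assoc m r (n ∸ r)) (≡.cong (m +_) (ℕₚ.m+[n∸m]≡n r≤n)))
    beyond : ∀ c → f (suc (m + r) + c) ≈ 0#
    beyond c = term-above r (m + r) (n ∸ r) t (s≤s (ℕₚ.m≤m+n (m + r) c))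

  -- If a < r every summand vanishes: [a,c] = 0 for c > a and [b,c-r] = 0 for c < r.
  closed-vanish : ∀ r a b t → a < r → closed r a b t ≈ 0#
  closed-vanish r a b t a<r = trans (*-congˡ (sumTo-zero (suc a) _ summand)) (zeroʳ _)
    where
    summand : ∀ c → term r a b t c ≈ 0#
    summand c with c <? r
    ... | yes c<r = term-below r a b t c<r
    ... | no  c≮r = term-above r a b t (ℕₚ.<-≤-trans a<r (ℕₚ.≮⇒≥ c≮r))

  -- The recursion of the closed form for r ≥ 1, mirroring the first-step
  -- recursion of the paths:
  --   closed (r+1) (a+1) b t = closed (r+1) a b (q t) + q t · closed r a b (q t).
  -- Termwise, the q-Pascal rule [a+1,d+1] = [a,d] + q^(d+1) [a,d+1] splits
  -- the (d+1)-th summand; the [a,d] part is the d-th summand for r.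

  -- The [a,d] part, for any value γ of [b,d-r] (which vanishes unless r ≤ d).
  lower-part : ∀ r d (g γ t : A) → γ ≈ 0# ⊎ r ≤ d →
    (q ^ (suc (suc r) C 2)) ⊗ (g ⊗ γ ⊗ (q ^ (suc d * (d ∸ r))) ⊗ (t ⊗ (t ^ d)))
      ≈ (q ⊗ t) ⊗ ((q ^ (suc r C 2)) ⊗ (g ⊗ γ ⊗ (q ^ (d * (d ∸ r))) ⊗ ((q ⊗ t) ^ d)))
  lower-part r d g γ t (inj₁ γ≈0) = trans (vanishes _) (sym (trans (*-congˡ (vanishes _)) (zeroʳ _)))
    where
    vanishes : ∀ Q {P τ} → Q ⊗ (g ⊗ γ ⊗ P ⊗ τ) ≈ 0#
    vanishes Q = trans (*-congˡ (factor₂-zero g _ _ γ≈0)) (zeroʳ Q)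
  lower-part r d g γ t (inj₂ r≤d) = begin
    Q₂ ⊗ (g ⊗ γ ⊗ P₁ ⊗ (t ⊗ (t ^ d)))              ≈⟨ regroup₁ Q₂ g γ P₁ t (t ^ d) ⟩
    (Q₂ ⊗ P₁) ⊗ (g ⊗ γ ⊗ (t ⊗ (t ^ d)))            ≈⟨ *-congʳ powers ⟩
    (q ⊗ (Q₁ ⊗ ((q ^ d) ⊗ P₀))) ⊗ (g ⊗ γ ⊗ (t ⊗ (t ^ d)))
                                                   ≈⟨ regroup₂ q Q₁ (q ^ d) P₀ g γ t (t ^ d) ⟩
    (q ⊗ t) ⊗ (Q₁ ⊗ (g ⊗ γ ⊗ P₀ ⊗ ((q ^ d) ⊗ (t ^ d))))
                                                   ≈⟨ *-congˡ (*-congˡ (*-congˡ (^-distrib-* q t d))) ⟨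
    (q ⊗ t) ⊗ (Q₁ ⊗ (g ⊗ γ ⊗ P₀ ⊗ ((q ⊗ t) ^ d)))   ∎
    where
    e  = d ∸ r
    Q₂ = q ^ (suc (suc r) C 2)
    Q₁ = q ^ (suc r C 2)
    P₁ = q ^ (suc d * e)
    P₀ = q ^ (d * e)
    powers : Q₂ ⊗ P₁ ≈ q ⊗ (Q₁ ⊗ ((q ^ d) ⊗ P₀))
    powers = begin
      Q₂ ⊗ P₁                                  ≈⟨ ^-homo-* q (suc (suc r) C 2) (suc d * e) ⟨
      q ^ (suc (suc r) C 2 + suc d * e)        ≈⟨ ^-congʳ q (corner-exponent r≤d) ⟩
      q ⊗ (q ^ (suc r C 2 + (d + d * e)))      ≈⟨ *-congˡ (^-homo-* q (suc r C 2) (d + d * e)) ⟩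
      q ⊗ (Q₁ ⊗ (q ^ (d + d * e)))             ≈⟨ *-congˡ (*-congˡ (^-homo-* q d (d * e))) ⟩
      q ⊗ (Q₁ ⊗ ((q ^ d) ⊗ P₀))                ∎
    regroup₁ : ∀ Q g γ P t T → Q ⊗ (g ⊗ γ ⊗ P ⊗ (t ⊗ T)) ≈ (Q ⊗ P) ⊗ (g ⊗ γ ⊗ (t ⊗ T))
    regroup₁ = solve 6 (λ Q g γ P t T → Q :* (g :* γ :* P :* (t :* T)) := (Q :* P) :* (g :* γ :* (t :* T))) refl
    regroup₂ : ∀ q Q δ P g γ t T →
      (q ⊗ (Q ⊗ (δ ⊗ P))) ⊗ (g ⊗ γ ⊗ (t ⊗ T)) ≈ (q ⊗ t) ⊗ (Q ⊗ (g ⊗ γ ⊗ P ⊗ (δ ⊗ T)))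
    regroup₂ = solve 8 (λ q Q δ P g γ t T →
      (q :* (Q :* (δ :* P))) :* (g :* γ :* (t :* T)) := (q :* t) :* (Q :* (g :* γ :* P :* (δ :* T)))) refl

  term-step : ∀ r a b t d →
    (q ^ (suc (suc r) C 2)) ⊗ term (suc r) (suc a) b t (suc d)
      ≈ (q ^ (suc (suc r) C 2)) ⊗ term (suc r) a b (q ⊗ t) (suc d)
        ⊕ (q ⊗ t) ⊗ ((q ^ (suc r C 2)) ⊗ term r a b (q ⊗ t) d)
  term-step r a b t d = begin
    Q₂ ⊗ ((gauss q a d ⊕ (q ^ suc d) ⊗ g') ⊗ γ' ⊗ P₁ ⊗ (t ^ suc d))
      ≈⟨ pascal-split Q₂ (gauss q a d) (q ^ suc d) g' γ' P₁ (t ^ suc d) ⟩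
    Q₂ ⊗ (g' ⊗ γ' ⊗ P₁ ⊗ ((q ^ suc d) ⊗ (t ^ suc d))) ⊕ Q₂ ⊗ (gauss q a d ⊗ γ' ⊗ P₁ ⊗ (t ^ suc d))
      ≈⟨ +-congʳ (*-congˡ (*-congˡ (^-distrib-* q t (suc d)))) ⟨
    Q₂ ⊗ term (suc r) a b (q ⊗ t) (suc d) ⊕ Q₂ ⊗ (gauss q a d ⊗ γ' ⊗ P₁ ⊗ (t ^ suc d))
      ≡⟨ ≡.cong (λ γ → Q₂ ⊗ term (suc r) a b (q ⊗ t) (suc d) ⊕ Q₂ ⊗ (gauss q a d ⊗ γ ⊗ P₁ ⊗ (t ^ suc d)))
                (gaussShift-suc b d r) ⟩
    Q₂ ⊗ term (suc r) a b (q ⊗ t) (suc d) ⊕ Q₂ ⊗ (gauss q a d ⊗ γ ⊗ P₁ ⊗ (t ^ suc d))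
      ≈⟨ +-congˡ (lower-part r d (gauss q a d) γ t (gaussShift-cases b d r)) ⟩
    Q₂ ⊗ term (suc r) a b (q ⊗ t) (suc d) ⊕ (q ⊗ t) ⊗ ((q ^ (suc r C 2)) ⊗ term r a b (q ⊗ t) d) ∎
    where
    Q₂ = q ^ (suc (suc r) C 2)
    g' = gauss q a (suc d)
    γ' = gaussShift q b (suc d) (suc r)
    γ  = gaussShift q b d r
    P₁ = q ^ (suc d * (d ∸ r))
    pascal-split : ∀ Q g p g' γ P T →
      Q ⊗ ((g ⊕ p ⊗ g') ⊗ γ ⊗ P ⊗ T) ≈ Q ⊗ (g' ⊗ γ ⊗ P ⊗ (p ⊗ T)) ⊕ Q ⊗ (g ⊗ γ ⊗ P ⊗ T)
    pascal-split = solve 7 (λ Q g p g' γ P T →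
      Q :* ((g :+ p :* g') :* γ :* P :* T) := Q :* (g' :* γ :* P :* (p :* T)) :+ Q :* (g :* γ :* P :* T)) refl

  closed-step : ∀ r a b t →
    closed (suc r) (suc a) b t ≈ closed (suc r) a b (q ⊗ t) ⊕ (q ⊗ t) ⊗ closed r a b (q ⊗ t)
  closed-step r a b t = begin
    Q₂ ⊗ sumTo (suc (suc a)) f
      ≈⟨ *-congˡ (trans (+-congʳ (term-below (suc r) (suc a) b t (s≤s z≤n))) (+-identityˡ _)) ⟩
    Q₂ ⊗ sumTo (suc a) (λ d → f (suc d))
      ≈⟨ sumTo-* (suc a) Q₂ (λ d → f (suc d)) ⟨
    sumTo (suc a) (λ d → Q₂ ⊗ f (suc d))
      ≈⟨ sumTo-cong (suc a) (term-step r a b t) ⟩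
    sumTo (suc a) (λ d → Q₂ ⊗ f₁ (suc d) ⊕ (q ⊗ t) ⊗ (Q₁ ⊗ f₀ d))
      ≈⟨ sumTo-+ (suc a) (λ d → Q₂ ⊗ f₁ (suc d)) (λ d → (q ⊗ t) ⊗ (Q₁ ⊗ f₀ d)) ⟩
    sumTo (suc a) (λ d → Q₂ ⊗ f₁ (suc d)) ⊕ sumTo (suc a) (λ d → (q ⊗ t) ⊗ (Q₁ ⊗ f₀ d))
      ≈⟨ +-cong (sumTo-* (suc a) Q₂ (λ d → f₁ (suc d)))
                (trans (sumTo-* (suc a) (q ⊗ t) (λ d → Q₁ ⊗ f₀ d)) (*-congˡ (sumTo-* (suc a) Q₁ f₀))) ⟩
    Q₂ ⊗ sumTo (suc a) (λ d → f₁ (suc d)) ⊕ (q ⊗ t) ⊗ (Q₁ ⊗ sumTo (suc a) f₀)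
      ≈⟨ +-congʳ (*-congˡ (sumTo-shift (suc a) f₁ (term-below (suc r) a b (q ⊗ t) (s≤s z≤n))
                                                   (term-above (suc r) a b (q ⊗ t) ℕₚ.≤-refl))) ⟩
    Q₂ ⊗ sumTo (suc a) f₁ ⊕ (q ⊗ t) ⊗ (Q₁ ⊗ sumTo (suc a) f₀) ∎
    where
    Q₂ = q ^ (suc (suc r) C 2)
    Q₁ = q ^ (suc r C 2)
    f  = term (suc r) (suc a) b t
    f₁ = term (suc r) a b (q ⊗ t)
    f₀ = term r a b (q ⊗ t)

  -- For r = 0 the summand is [a,c] [b,c] q^(c²) t^c.  Its recursion involves
  -- the closed form of the paths whose start is a potential corner:
  -- pendingClosed a b t = Σ_{d ≤ a} [a,d] [b,d+1] q^((d+1)d) t^(d+1).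
  pendingTerm : ℕ → ℕ → A → ℕ → A
  pendingTerm a b t d = gauss q a d ⊗ gauss q b (suc d) ⊗ (q ^ (suc d * d)) ⊗ (t ^ suc d)

  pendingClosed : ℕ → ℕ → A → A
  pendingClosed a b t = sumTo (suc a) (pendingTerm a b t)

  square-split : ∀ d → q ^ (suc d * suc d) ≈ (q ^ (suc d * d)) ⊗ (q ^ suc d)
  square-split d = trans (^-congʳ q (≡.trans (ℕₚ.*-suc (suc d) d) (ℕₚ.+-comm (suc d) (suc d * d))))
                         (^-homo-* q (suc d * d) (suc d))

  -- q-Pascal rule in the first Gaussian polynomial.
  term₀-step : ∀ a b t d → term 0 (suc a) b t (suc d) ≈ term 0 a b (q ⊗ t) (suc d) ⊕ pendingTerm a b (q ⊗ t) d
  term₀-step a b t d = begin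
    (g ⊕ Q ⊗ g') ⊗ h ⊗ (q ^ (suc d * suc d)) ⊗ τ         ≈⟨ *-congʳ (*-congˡ (square-split d)) ⟩
    (g ⊕ Q ⊗ g') ⊗ h ⊗ (P ⊗ Q) ⊗ τ                      ≈⟨ pascal g g' h P Q τ ⟩
    g' ⊗ h ⊗ (P ⊗ Q) ⊗ (Q ⊗ τ) ⊕ g ⊗ h ⊗ P ⊗ (Q ⊗ τ)
      ≈⟨ +-cong (*-cong (*-congˡ (square-split d)) (^-distrib-* q t (suc d)))
                (*-congˡ (^-distrib-* q t (suc d))) ⟨
    term 0 a b (q ⊗ t) (suc d) ⊕ pendingTerm a b (q ⊗ t) d ∎
    where
    g  = gauss q a d
    g' = gauss q a (suc d)
    h  = gauss q b (suc d)
    Q  = q ^ suc d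
    P  = q ^ (suc d * d)
    τ  = t ^ suc d
    pascal : ∀ g g' h P Q T →
      (g ⊕ Q ⊗ g') ⊗ h ⊗ (P ⊗ Q) ⊗ T ≈ g' ⊗ h ⊗ (P ⊗ Q) ⊗ (Q ⊗ T) ⊕ g ⊗ h ⊗ P ⊗ (Q ⊗ T)
    pascal = solve 6 (λ g g' h P Q T →
      (g :+ Q :* g') :* h :* (P :* Q) :* T := g' :* h :* (P :* Q) :* (Q :* T) :+ g :* h :* P :* (Q :* T)) refl

  -- q-Pascal rule in the second Gaussian polynomial.
  pendingTerm-step : ∀ a b t d →
    pendingTerm a (suc b) t d ≈ t ⊗ term 0 a b (q ⊗ t) d ⊕ pendingTerm a b (q ⊗ t) d
  pendingTerm-step a b t d = begin
    g ⊗ (h ⊕ (q ⊗ qᵈ) ⊗ h') ⊗ (q ^ (d + d * d)) ⊗ (t ⊗ tᵈ) ≈⟨ *-congʳ (*-congˡ (^-homo-* q d (d * d))) ⟩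
    g ⊗ (h ⊕ (q ⊗ qᵈ) ⊗ h') ⊗ (qᵈ ⊗ P) ⊗ (t ⊗ tᵈ)          ≈⟨ pascal g h h' q qᵈ P t tᵈ ⟩
    t ⊗ (g ⊗ h ⊗ P ⊗ (qᵈ ⊗ tᵈ)) ⊕ g ⊗ h' ⊗ (qᵈ ⊗ P) ⊗ ((q ⊗ qᵈ) ⊗ (t ⊗ tᵈ))
      ≈⟨ +-cong (*-congˡ (*-congˡ (^-distrib-* q t d)))
                (*-cong (*-congˡ (^-homo-* q d (d * d))) (^-distrib-* q t (suc d))) ⟨
    t ⊗ term 0 a b (q ⊗ t) d ⊕ pendingTerm a b (q ⊗ t) d ∎
    where
    g  = gauss q a d
    h  = gauss q b d
    h' = gauss q b (suc d)
    qᵈ = q ^ d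
    P  = q ^ (d * d)
    tᵈ = t ^ d
    pascal : ∀ g h h' q qᵈ P t tᵈ →
      g ⊗ (h ⊕ (q ⊗ qᵈ) ⊗ h') ⊗ (qᵈ ⊗ P) ⊗ (t ⊗ tᵈ) ≈ t ⊗ (g ⊗ h ⊗ P ⊗ (qᵈ ⊗ tᵈ)) ⊕ g ⊗ h' ⊗ (qᵈ ⊗ P) ⊗ ((q ⊗ qᵈ) ⊗ (t ⊗ tᵈ))
    pascal = solve 8 (λ g h h' q qᵈ P t tᵈ →
      g :* (h :+ (q :* qᵈ) :* h') :* (qᵈ :* P) :* (t :* tᵈ)
        := t :* (g :* h :* P :* (qᵈ :* tᵈ)) :+ g :* h' :* (qᵈ :* P) :* ((q :* qᵈ) :* (t :* tᵈ))) refl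

  closed₀-step : ∀ a b t → closedSum 0 (suc a) b t ≈ closedSum 0 a b (q ⊗ t) ⊕ pendingClosed a b (q ⊗ t)
  closed₀-step a b t = begin
    f₁ 0 ⊕ sumTo (suc a) (λ d → f (suc d))
      ≈⟨ +-congˡ (sumTo-cong (suc a) (term₀-step a b t)) ⟩
    f₁ 0 ⊕ sumTo (suc a) (λ d → f₁ (suc d) ⊕ g d)
      ≈⟨ +-congˡ (sumTo-+ (suc a) (λ d → f₁ (suc d)) g) ⟩
    f₁ 0 ⊕ (sumTo (suc a) (λ d → f₁ (suc d)) ⊕ sumTo (suc a) g)
      ≈⟨ +-assoc _ _ _ ⟨
    sumTo (suc (suc a)) f₁ ⊕ sumTo (suc a) g
      ≈⟨ +-congʳ (sumTo-last-zero (suc a) f₁ (term-above 0 a b (q ⊗ t) ℕₚ.≤-refl)) ⟩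
    sumTo (suc a) f₁ ⊕ sumTo (suc a) g ∎
    where
    f  = term 0 (suc a) b t
    f₁ = term 0 a b (q ⊗ t)
    g  = pendingTerm a b (q ⊗ t)

  pendingClosed-step : ∀ a b t →
    pendingClosed a (suc b) t ≈ t ⊗ closedSum 0 a b (q ⊗ t) ⊕ pendingClosed a b (q ⊗ t)
  pendingClosed-step a b t =
    trans (sumTo-cong (suc a) (pendingTerm-step a b t))
          (trans (sumTo-+ (suc a) (λ d → t ⊗ term 0 a b (q ⊗ t) d) (pendingTerm a b (q ⊗ t)))
                 (+-congʳ (sumTo-* (suc a) t (term 0 a b (q ⊗ t)))))

  -- With no columns there is no corner: [0,d+1] = 0.
  pendingClosed-zero : ∀ a t → pendingClosed a 0 t ≈ 0#
  pendingClosed-zero a t = sumTo-zero (suc a) _ (λ d → factor₂-zero (gauss q a d) (q ^ (suc d * d)) (t ^ suc d) refl)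

  -- With no rows only the empty corner set remains.
  closedSum₀-top : ∀ b t → closedSum 0 0 b t ≈ 1#
  closedSum₀-top b t = solve 0 (((con 1 :* con 1) :* con 1) :* con 1 :+ con 0 := con 1) refl

  -- The single path of a 0 × n grid has no corners.
  pendingSum-top : ∀ u n → pendingSum u 0 n ≈ 1#
  pendingSum-top u zero    = +-identityʳ 1#
  pendingSum-top u (suc n) = trans (pathSum-right (pending u) n) (pendingSum-top (q ⊗ u) n)

  weightSum₀-top : ∀ u n → weightSum 0 u 0 n ≈ 1#
  weightSum₀-top u zero    = +-identityʳ 1#
  weightSum₀-top u (suc n) = trans (pathSum-right (weight 0 u) n) (pendingSum-top (q ⊗ u) n)

  -- The case r = 0 (true corners only), together with the sums from a
  -- potential corner, by simultaneous induction on the grid.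
  mutual
    weightSum₀-closed : ∀ m n u → weightSum 0 u m n ≈ closedSum 0 m n u
    weightSum₀-closed zero n u = trans (weightSum₀-top u n) (sym (closedSum₀-top n u))
    weightSum₀-closed (suc m) zero u = begin
      weightSum 0 u (suc m) 0                              ≈⟨ pathSum-down (weight 0 u) m ⟩
      weightSum 0 (q ⊗ u) m 0                              ≈⟨ weightSum₀-closed m 0 (q ⊗ u) ⟩
      closedSum 0 m 0 (q ⊗ u)                              ≈⟨ +-identityʳ _ ⟨
      closedSum 0 m 0 (q ⊗ u) ⊕ 0#                         ≈⟨ +-congˡ (pendingClosed-zero m (q ⊗ u)) ⟨
      closedSum 0 m 0 (q ⊗ u) ⊕ pendingClosed m 0 (q ⊗ u)  ≈⟨ closed₀-step m 0 u ⟨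
      closedSum 0 (suc m) 0 u                              ∎
    weightSum₀-closed (suc m) (suc n) u = begin
      weightSum 0 u (suc m) (suc n)
        ≈⟨ pathSum-split (weight 0 u) m n ⟩
      weightSum 0 (q ⊗ u) m (suc n) ⊕ pendingSum (q ⊗ u) (suc m) n
        ≈⟨ +-cong (weightSum₀-closed m (suc n) (q ⊗ u)) (pendingSum-closed m n (q ⊗ u)) ⟩
      closedSum 0 m (suc n) (q ⊗ u) ⊕ pendingClosed m (suc n) (q ⊗ u)
        ≈⟨ closed₀-step m (suc n) u ⟨
      closedSum 0 (suc m) (suc n) u ∎

    pendingSum-closed : ∀ m n u → pendingSum u (suc m) n ≈ pendingClosed m (suc n) u
    pendingSum-closed m zero u = begin
      pendingSum u (suc m) 0                                   ≈⟨ pathSum-down (pending u) m ⟩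
      pathSum (λ s → u ⊗ weight 0 (q ⊗ u) s) m 0               ≈⟨ pathSum-* u (weight 0 (q ⊗ u)) m 0 ⟩
      u ⊗ weightSum 0 (q ⊗ u) m 0                              ≈⟨ *-congˡ (weightSum₀-closed m 0 (q ⊗ u)) ⟩
      u ⊗ closedSum 0 m 0 (q ⊗ u)                              ≈⟨ +-identityʳ _ ⟨
      u ⊗ closedSum 0 m 0 (q ⊗ u) ⊕ 0#                         ≈⟨ +-congˡ (pendingClosed-zero m (q ⊗ u)) ⟨
      u ⊗ closedSum 0 m 0 (q ⊗ u) ⊕ pendingClosed m 0 (q ⊗ u)  ≈⟨ pendingClosed-step m 0 u ⟨
      pendingClosed m 1 u                                      ∎
    pendingSum-closed m (suc n) u = begin
      pendingSum u (suc m) (suc n)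
        ≈⟨ pathSum-split (pending u) m n ⟩
      pathSum (λ s → u ⊗ weight 0 (q ⊗ u) s) m (suc n) ⊕ pendingSum (q ⊗ u) (suc m) n
        ≈⟨ +-cong (trans (pathSum-* u (weight 0 (q ⊗ u)) m (suc n)) (*-congˡ (weightSum₀-closed m (suc n) (q ⊗ u))))
                  (pendingSum-closed m n (q ⊗ u)) ⟩
      u ⊗ closedSum 0 m (suc n) (q ⊗ u) ⊕ pendingClosed m (suc n) (q ⊗ u)
        ≈⟨ pendingClosed-step m (suc n) u ⟨
      pendingClosed m (suc (suc n)) u ∎

  weightSum-closed : ∀ r m n u → r ≤ n → weightSum r u m n ≈ closed r (m + r) (n ∸ r) u
  weightSum-closed zero m n u _ = begin
    weightSum 0 u m n                     ≈⟨ weightSum₀-closed m n u ⟩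
    closedSum 0 m n u                     ≈⟨ *-identityˡ _ ⟨
    closed 0 m n u                        ≡⟨ ≡.cong (λ a → closed 0 a n u) (ℕₚ.+-identityʳ m) ⟨
    closed 0 (m + 0) n u                  ∎
  weightSum-closed (suc r) zero (suc n) u (s≤s r≤n) = begin
    weightSum (suc r) u 0 (suc n)
      ≈⟨ trans (pathSum-right (weight (suc r) u) n) (pathSum-* (q ⊗ u) (weight r (q ⊗ u)) 0 n) ⟩
    (q ⊗ u) ⊗ weightSum r (q ⊗ u) 0 n
      ≈⟨ *-congˡ (weightSum-closed r 0 n (q ⊗ u) r≤n) ⟩
    (q ⊗ u) ⊗ closed r r (n ∸ r) (q ⊗ u)
      ≈⟨ +-identityˡ _ ⟨
    0# ⊕ (q ⊗ u) ⊗ closed r r (n ∸ r) (q ⊗ u)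
      ≈⟨ +-congʳ (closed-vanish (suc r) r (n ∸ r) (q ⊗ u) ℕₚ.≤-refl) ⟨
    closed (suc r) r (n ∸ r) (q ⊗ u) ⊕ (q ⊗ u) ⊗ closed r r (n ∸ r) (q ⊗ u)
      ≈⟨ closed-step r r (n ∸ r) u ⟨
    closed (suc r) (suc r) (n ∸ r) u ∎
  weightSum-closed (suc r) (suc m) (suc n) u (s≤s r≤n) = begin
    weightSum (suc r) u (suc m) (suc n)
      ≈⟨ pathSum-split (weight (suc r) u) m n ⟩
    weightSum (suc r) (q ⊗ u) m (suc n) ⊕ pathSum (λ s → (q ⊗ u) ⊗ weight r (q ⊗ u) s) (suc m) n
      ≈⟨ +-congˡ (pathSum-* (q ⊗ u) (weight r (q ⊗ u)) (suc m) n) ⟩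
    weightSum (suc r) (q ⊗ u) m (suc n) ⊕ (q ⊗ u) ⊗ weightSum r (q ⊗ u) (suc m) n
      ≈⟨ +-cong (weightSum-closed (suc r) m (suc n) (q ⊗ u) (s≤s r≤n))
                (*-congˡ (weightSum-closed r (suc m) n (q ⊗ u) r≤n)) ⟩
    closed (suc r) (m + suc r) b (q ⊗ u) ⊕ (q ⊗ u) ⊗ closed r (suc m + r) b (q ⊗ u)
      ≡⟨ ≡.cong (λ a → closed (suc r) (m + suc r) b (q ⊗ u) ⊕ (q ⊗ u) ⊗ closed r a b (q ⊗ u)) (ℕₚ.+-suc m r) ⟨
    closed (suc r) (m + suc r) b (q ⊗ u) ⊕ (q ⊗ u) ⊗ closed r (m + suc r) b (q ⊗ u)
      ≈⟨ closed-step r (m + suc r) b u ⟨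
    closed (suc r) (suc m + suc r) b u ∎
    where b = n ∸ r

proposition5 : {c ℓ : Level} (S : CommutativeSemiring c ℓ)
    → (q t : CommutativeSemiring.Carrier S) (m n r : ℕ) → r ≤ n
    → CommutativeSemiring._≈_ S (Poly.lhs S q t m n r) (Poly.rhs S q t m n r)
proposition5 S q t m n r r≤n =
  trans (lhs≈weightSum t m n r) (trans (weightSum-closed r m n t r≤n) (sym (rhs≈closed t m n r r≤n)))
  where
  open Proof S q
  open CommutativeSemiring S using (trans; sym)
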